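{- Let $n\ge 2$ and let $D$ be a strict digraph on $n$ vertices without isolated vertices. Then $h(D)\le\frac n2$, with equality if and only if every arc $uv$ of $D$ satisfies $d_u^+=d_v^-$ and every vertex of $D$ has positive out-degree and positive in-degree; and $h(D)\ge\frac{n-1}{n}$, with equality if and only if $D$ is $\vec K_{1,n-1}$ or $\vec K_{n-1,1}$.
   Context: A strict digraph has no loops and at most one arc from $u$ to $v$ for each ordered pair of distinct vertices; $d_u^+$, $d_u^-$ denote out- and in-degree, and a vertex is isolated if both are $0$. The harmonic index is $h(D)=\frac12\sum_{uv\in A}\frac{2}{d_u^++d_v^- }$. $\vec K_{1,n-1}$ (resp. $\vec K_{n-1,1}$) is the oriented star on $n$ vertices with all arcs directed from the center to the leaves (resp. from the leaves to the center). -}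

module Defs where

open import Data.Nat using (ℕ; zero; suc; _+_)
open import Data.Integer using (+_)
open import Data.Fin using (Fin)
open import Data.Bool using (Bool; true; false; if_then_else_)
open import Data.List using (List; map; foldr; allFin)
open import Data.Rational using (ℚ; _/_; 0ℚ) renaming (_+_ to _+ℚ_)
open import Relation.Binary.PropositionalEquality using (_≡_; _≢_)
open import Data.Product using (_×_; Σ)
open import Relation.Nullary using (¬_)
open import Function.Bundles using (_⇔_)

-- a / d as a rational; the d = 0 case (value 0) is a totality convention that
-- is never used by the statement (all denominators occurring are positive).
frac : ℕ → ℕ → ℚ
frac a zero    = 0ℚ
frac a (suc d) = + a / suc d

Σℕ : ∀ {n} → (Fin n → ℕ) → ℕ
Σℕ {n} f = foldr _+_ 0 (map f (allFin n))

Σℚ : ∀ {n} → (Fin n → ℚ) → ℚ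
Σℚ {n} f = foldr _+ℚ_ 0ℚ (map f (allFin n))

-- A strict digraph on vertex set Fin n: adjacency relation without loops
-- (at most one arc per ordered pair is automatic for a Bool-valued relation).
record Digraph (n : ℕ) : Set where
  field
    arc     : Fin n → Fin n → Bool
    noLoops : ∀ u → arc u u ≡ false
open Digraph public

indicator : Bool → ℕ
indicator true  = 1
indicator false = 0

outdeg : ∀ {n} → Digraph n → Fin n → ℕ
outdeg D u = Σℕ (λ v → indicator (arc D u v))

indeg : ∀ {n} → Digraph n → Fin n → ℕ
indeg D v = Σℕ (λ u → indicator (arc D u v))

Isolated : ∀ {n} → Digraph n → Fin n → Set
Isolated D u = (outdeg D u ≡ 0) × (indeg D u ≡ 0)

-- harmonic index h(D) = (1/2) Σ_{uv ∈ A} 2/(d⁺_u + d⁻_v) = Σ_{uv ∈ A} 1/(d⁺_u + d⁻_v)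
harmonic : ∀ {n} → Digraph n → ℚ
harmonic D = Σℚ (λ u → Σℚ (λ v →
  if arc D u v then frac 1 (outdeg D u + indeg D v) else 0ℚ))

-- D is (labelled-isomorphic to) the out-star K_{1,n-1}: some centre c with
-- arcs exactly c → v for every v ≠ c.
IsOutStar : ∀ {n} → Digraph n → Set
IsOutStar {n} D = Σ (Fin n) λ c → ∀ u v → (arc D u v ≡ true) ⇔ ((u ≡ c) × (v ≢ c))

IsInStar : ∀ {n} → Digraph n → Set
IsInStar {n} D = Σ (Fin n) λ c → ∀ u v → (arc D u v ≡ true) ⇔ ((u ≢ c) × (v ≡ c))

-- Write x = d⁺_u and y = d⁻_v for an arc uv, so that 1 ≤ x, y ≤ m := n − 1.  The summand
-- 1/(x+y) of h(D) is squeezed between m/(m+1)² · (1/x + 1/y) and ¼ · (1/x + 1/y): the upper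
-- comparison is AM–GM (equality iff x = y), the lower one is
-- (m+1)²xy − m(x+y)² = (mx − y)(my − x) ≥ 0 (equality only if x = m or y = m).
-- Summed over the arcs, 1/x + 1/y counts every vertex once for a positive out-degree and once
-- for a positive in-degree, which gives between n (no isolated vertices) and 2n.  Hence
-- n · m/(m+1)² = (n−1)/n ≤ h(D) ≤ n/2.  Equality below makes every vertex a pure source or a
-- pure sink and puts an end of degree n − 1 on some arc, which forces a star; reversing all
-- arcs exchanges the two stars and preserves h.
module Submission where

open import Algebra.Bundles using (Ring)
open import Algebra.Core using (Op₂)
open import Algebra.Definitions using (Commutative)
open import Data.Bool using (Bool; true; false; if_then_else_; not; _∧_)
open import Data.Empty using (⊥-elim)
open import Data.Fin as Fin using (Fin)
open import Data.Fin.Properties using (_≟_)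
open import Data.Integer as ℤ using (+_)
import Data.Integer.Properties as ℤ
import Data.List as List
import Data.List.Properties as List
open import Data.Nat as ℕ using (ℕ; zero; suc; _+_; _*_; _∸_; ∣_-_∣; _≤_; _<_; z≤n; s≤s; z<s)
import Data.Nat.Properties as ℕ
open import Data.Nat.Tactic.RingSolver using (solve-∀)
open import Data.Product as Product using (_×_; _,_; proj₁; proj₂; ∃)
open import Data.Product.Function.NonDependent.Propositional using (_×-⇔_)
open import Data.Rational as ℚ using (ℚ; 0ℚ; 1ℚ) renaming (_≤_ to _≤ℚ_)
import Data.Rational.Properties as ℚ
open import Data.Rational.Unnormalised as ℚᵘ using (mkℚᵘ; *≤*)
import Data.Rational.Unnormalised.Properties as ℚᵘ
open import Data.Sum as Sum using (_⊎_; inj₁; inj₂; [_,_]′; reduce)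
import Data.Vec.Functional as Vector
open import Function.Base using (id; _∘_; case_of_)
open import Function.Bundles using (_⇔_; mk⇔; Equivalence)
open import Function.Properties.Equivalence using () renaming (trans to ⇔-trans)
open import Level using (0ℓ)
open import Relation.Binary.Core using (Rel; _Preserves₂_⟶_⟶_)
open import Relation.Binary.Definitions using (Reflexive; Antisymmetric; Irreflexive)
open import Relation.Binary.PropositionalEquality
  using (_≡_; _≢_; refl; sym; trans; cong; cong₂; subst; subst₂; module ≡-Reasoning)
open import Relation.Nullary using (¬_; does; yes; no)
open import Relation.Nullary.Decidable using (dec-true; dec-false)

open import Defs

open Equivalence using (to; from)

private
  toℚᵘ-frac : ∀ a b → ℚ.toℚᵘ (frac a (suc b)) ℚᵘ.≃ mkℚᵘ (+ a) b
  toℚᵘ-frac a b = ℚ.toℚᵘ-fromℚᵘ (mkℚᵘ (+ a) b)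

  frac≃ : ∀ a b → mkℚᵘ (+ a) b ℚᵘ.≃ ℚ.toℚᵘ (frac a (suc b))
  frac≃ a b = ℚᵘ.≃-sym (toℚᵘ-frac a b)

frac-≤ : ∀ a b c d → 0 < b → 0 < d → (a * d ≤ c * b) ⇔ (frac a b ≤ℚ frac c d)
frac-≤ a (suc b) c (suc d) _ _ = mk⇔
  (λ ad≤cb → ℚ.toℚᵘ-cancel-≤ (ℚᵘ.≤-respˡ-≃ (frac≃ a b) (ℚᵘ.≤-respʳ-≃ (frac≃ c d)
    (*≤* (subst₂ ℤ._≤_ (ℤ.pos-* a (suc d)) (ℤ.pos-* c (suc b)) (ℤ.+≤+ ad≤cb))))))
  (λ a/b≤c/d →
    case ℚᵘ.≤-respˡ-≃ (toℚᵘ-frac a b) (ℚᵘ.≤-respʳ-≃ (toℚᵘ-frac c d) (ℚ.toℚᵘ-mono-≤ a/b≤c/d)) of λ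
    { (*≤* ad≤cb) → ℤ.drop‿+≤+ (subst₂ ℤ._≤_ (sym (ℤ.pos-* a (suc d))) (sym (ℤ.pos-* c (suc b))) ad≤cb) })

frac-≡ : ∀ a b c d → 0 < b → 0 < d → (a * d ≡ c * b) ⇔ (frac a b ≡ frac c d)
frac-≡ a b c d 0<b 0<d = mk⇔
  (λ ad≡cb → ℚ.≤-antisym (to (frac-≤ a b c d 0<b 0<d) (ℕ.≤-reflexive ad≡cb))
                         (to (frac-≤ c d a b 0<d 0<b) (ℕ.≤-reflexive (sym ad≡cb))))
  (λ a/b≡c/d → ℕ.≤-antisym (from (frac-≤ a b c d 0<b 0<d) (ℚ.≤-reflexive a/b≡c/d))
                           (from (frac-≤ c d a b 0<d 0<b) (ℚ.≤-reflexive (sym a/b≡c/d))))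

frac-+ : ∀ a b c d → 0 < b → 0 < d → frac a b ℚ.+ frac c d ≡ frac (a * d + c * b) (b * d)
frac-+ a (suc b) c (suc d) _ _ = ℚ.toℚᵘ-injective (begin
  ℚ.toℚᵘ (frac a (suc b) ℚ.+ frac c (suc d))            ≈⟨ ℚ.toℚᵘ-homo-+ (frac a (suc b)) (frac c (suc d)) ⟩
  ℚ.toℚᵘ (frac a (suc b)) ℚᵘ.+ ℚ.toℚᵘ (frac c (suc d)) ≈⟨ ℚᵘ.+-cong (toℚᵘ-frac a b) (toℚᵘ-frac c d) ⟩
  mkℚᵘ (+ a ℤ.* + suc d ℤ.+ + c ℤ.* + suc b) (d + b * suc d)
    ≡⟨ cong (λ k → mkℚᵘ k (d + b * suc d)) (sym (trans (ℤ.pos-+ (a * suc d) (c * suc b))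
                                            (cong₂ ℤ._+_ (ℤ.pos-* a (suc d)) (ℤ.pos-* c (suc b))))) ⟩
  mkℚᵘ (+ (a * suc d + c * suc b)) (d + b * suc d)       ≈⟨ frac≃ (a * suc d + c * suc b) (d + b * suc d) ⟩
  ℚ.toℚᵘ (frac (a * suc d + c * suc b) (suc b * suc d)) ∎)
  where open ℚᵘ.≃-Reasoning

frac-* : ∀ a b c d → 0 < b → 0 < d → frac a b ℚ.* frac c d ≡ frac (a * c) (b * d)
frac-* a (suc b) c (suc d) _ _ = ℚ.toℚᵘ-injective (begin
  ℚ.toℚᵘ (frac a (suc b) ℚ.* frac c (suc d))            ≈⟨ ℚ.toℚᵘ-homo-* (frac a (suc b)) (frac c (suc d)) ⟩
  ℚ.toℚᵘ (frac a (suc b)) ℚᵘ.* ℚ.toℚᵘ (frac c (suc d)) ≈⟨ ℚᵘ.*-cong (toℚᵘ-frac a b) (toℚᵘ-frac c d) ⟩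
  mkℚᵘ (+ a ℤ.* + c) (d + b * suc d)                    ≡⟨ cong (λ k → mkℚᵘ k (d + b * suc d)) (sym (ℤ.pos-* a c)) ⟩
  mkℚᵘ (+ (a * c)) (d + b * suc d)                      ≈⟨ frac≃ (a * c) (d + b * suc d) ⟩
  ℚ.toℚᵘ (frac (a * c) (suc b * suc d))                 ∎)
  where open ℚᵘ.≃-Reasoning

1/x+1/y≡[x+y]/xy : ∀ {x y} → 0 < x → 0 < y → frac 1 x ℚ.+ frac 1 y ≡ frac (x + y) (x * y)
1/x+1/y≡[x+y]/xy {x} {y} 0<x 0<y = trans (frac-+ 1 x 1 y 0<x 0<y)
  (cong (λ k → frac k (x * y)) (trans (cong₂ _+_ (ℕ.*-identityˡ y) (ℕ.*-identityˡ x)) (ℕ.+-comm y x)))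

¼ : ℚ
¼ = frac 1 4

m/[m+1]² : ℕ → ℚ
m/[m+1]² m = frac m (suc m * suc m)

fromℕ : ℕ → ℚ
fromℕ k = frac k 1

fromℕ-+ : ∀ a b → fromℕ (a + b) ≡ fromℕ a ℚ.+ fromℕ b
fromℕ-+ a b = sym (trans (frac-+ a 1 b 1 z<s z<s)
  (cong (λ k → frac k 1) (cong₂ _+_ (ℕ.*-identityʳ a) (ℕ.*-identityʳ b))))

sign : ℕ → ℚ
sign zero    = 0ℚ
sign (suc _) = 1ℚ

fromℕ*1/≡sign : ∀ k → fromℕ k ℚ.* frac 1 k ≡ sign k
fromℕ*1/≡sign zero    = refl
fromℕ*1/≡sign (suc k) = trans (frac-* (suc k) 1 1 (suc k) z<s z<s)
  (to (frac-≡ (suc k * 1) (1 * suc k) 1 1 z<s z<s) (cross (suc k)))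
  where
  cross : ∀ k → k * 1 * 1 ≡ 1 * (1 * k)
  cross = solve-∀

*-cancelˡ-≡-pos : ∀ r .{{_ : ℚ.Positive r}} {p q} → r ℚ.* p ≡ r ℚ.* q → p ≡ q
*-cancelˡ-≡-pos r eq =
  ℚ.≤-antisym (ℚ.*-cancelˡ-≤-pos r (ℚ.≤-reflexive eq)) (ℚ.*-cancelˡ-≤-pos r (ℚ.≤-reflexive (sym eq)))

≤-≤-squeeze : ∀ {a b c : ℚ} → a ≤ℚ b → b ≤ℚ c → (a ≡ c) ⇔ (a ≡ b × b ≡ c)
≤-≤-squeeze a≤b b≤c = mk⇔
  (λ { refl → ℚ.≤-antisym a≤b b≤c , ℚ.≤-antisym b≤c a≤b })
  (λ (a≡b , b≡c) → trans a≡b b≡c)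

-- Comparing 1/(x+y) with 1/x + 1/y

private
  m+n≡m⇒n≡0 : ∀ m {n} → m + n ≡ m → n ≡ 0
  m+n≡m⇒n≡0 m eq = ℕ.+-cancelˡ-≡ m _ 0 (trans eq (sym (ℕ.+-identityʳ m)))

  y≤m⇒y≤m*x : ∀ {m x y} → 0 < x → y ≤ m → y ≤ m * x
  y≤m⇒y≤m*x {m} {suc _} _ y≤m = ℕ.≤-trans y≤m (ℕ.m≤m*n m _)

[x+y]²≡4xy+∣x-y∣² : ∀ x y → (x + y) * (x + y) ≡ 4 * (x * y) + ∣ x - y ∣ * ∣ x - y ∣
[x+y]²≡4xy+∣x-y∣² x y = [ ordered , swapped ]′ (ℕ.≤-total x y)
  where
  identity : ∀ x k → (x + (x + k)) * (x + (x + k)) ≡ 4 * (x * (x + k)) + k * k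
  identity = solve-∀
  ordered : ∀ {x y} → x ≤ y → (x + y) * (x + y) ≡ 4 * (x * y) + ∣ x - y ∣ * ∣ x - y ∣
  ordered {x} {y} x≤y = subst (λ z → (x + z) * (x + z) ≡ 4 * (x * z) + ∣ x - z ∣ * ∣ x - z ∣) (ℕ.m+[n∸m]≡n x≤y)
    (trans (identity x (y ∸ x)) (cong (λ d → 4 * (x * (x + (y ∸ x))) + d * d) (sym (ℕ.∣m-m+n∣≡n x (y ∸ x)))))
  swapped : y ≤ x → (x + y) * (x + y) ≡ 4 * (x * y) + ∣ x - y ∣ * ∣ x - y ∣
  swapped y≤x = begin
    (x + y) * (x + y)                      ≡⟨ cong (λ z → z * z) (ℕ.+-comm x y) ⟩
    (y + x) * (y + x)                      ≡⟨ ordered y≤x ⟩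
    4 * (y * x) + ∣ y - x ∣ * ∣ y - x ∣    ≡⟨ cong₂ (λ a d → 4 * a + d * d) (ℕ.*-comm y x) (ℕ.∣-∣-comm y x) ⟩
    4 * (x * y) + ∣ x - y ∣ * ∣ x - y ∣    ∎
    where open ≡-Reasoning

4xy≤[x+y]² : ∀ x y → 4 * (x * y) ≤ (x + y) * (x + y)
4xy≤[x+y]² x y = subst (4 * (x * y) ≤_) (sym ([x+y]²≡4xy+∣x-y∣² x y)) (ℕ.m≤m+n _ _)

4xy≡[x+y]²⇒x≡y : ∀ x y → 4 * (x * y) ≡ (x + y) * (x + y) → x ≡ y
4xy≡[x+y]²⇒x≡y x y eq = ℕ.∣m-n∣≡0⇒m≡n (reduce (ℕ.m*n≡0⇒m≡0∨n≡0 ∣ x - y ∣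
  (m+n≡m⇒n≡0 (4 * (x * y)) (trans (sym ([x+y]²≡4xy+∣x-y∣² x y)) (sym eq)))))

-- The identity is proved with p = mx − y and q = my − x as fresh variables: after adding
-- yq + px + 2xy to both sides it becomes a semiring identity.
[m+1]²xy≡m[x+y]²+[mx∸y][my∸x] : ∀ m x y → y ≤ m * x → x ≤ m * y →
  (suc m * suc m) * (x * y) ≡ m * ((x + y) * (x + y)) + (m * x ∸ y) * (m * y ∸ x)
[m+1]²xy≡m[x+y]²+[mx∸y][my∸x] m x y y≤mx x≤my =
  with-gaps (m * x ∸ y) (m * y ∸ x) (ℕ.m+[n∸m]≡n y≤mx) (ℕ.m+[n∸m]≡n x≤my)
  where
  expand₁ : ∀ m x y p q → (suc m * suc m) * (x * y) + (y * q + p * x + 2 * (x * y))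
                        ≡ (suc m * suc m) * (x * y) + y * (x + q) + x * (y + p)
  expand₁ = solve-∀
  expand₂ : ∀ m x y → (suc m * suc m) * (x * y) + y * (m * y) + x * (m * x)
                    ≡ m * ((x + y) * (x + y)) + (m * x) * (m * y) + x * y
  expand₂ = solve-∀
  expand₃ : ∀ m x y p q → m * ((x + y) * (x + y)) + (y + p) * (x + q) + x * y
                        ≡ (m * ((x + y) * (x + y)) + p * q) + (y * q + p * x + 2 * (x * y))
  expand₃ = solve-∀
  with-gaps : ∀ p q → y + p ≡ m * x → x + q ≡ m * y →
    (suc m * suc m) * (x * y) ≡ m * ((x + y) * (x + y)) + p * q
  with-gaps p q y+p≡mx x+q≡my = ℕ.+-cancelʳ-≡ (y * q + p * x + 2 * (x * y)) _ _ (begin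
    (suc m * suc m) * (x * y) + (y * q + p * x + 2 * (x * y))       ≡⟨ expand₁ m x y p q ⟩
    (suc m * suc m) * (x * y) + y * (x + q) + x * (y + p)           ≡⟨ cong₂ (λ a b → (suc m * suc m) * (x * y) + y * a + x * b)
                                                                         x+q≡my y+p≡mx ⟩
    (suc m * suc m) * (x * y) + y * (m * y) + x * (m * x)           ≡⟨ expand₂ m x y ⟩
    m * ((x + y) * (x + y)) + (m * x) * (m * y) + x * y             ≡⟨ cong₂ (λ a b → m * ((x + y) * (x + y)) + a * b + x * y)
                                                                         (sym y+p≡mx) (sym x+q≡my) ⟩
    m * ((x + y) * (x + y)) + (y + p) * (x + q) + x * y             ≡⟨ expand₃ m x y p q ⟩
    (m * ((x + y) * (x + y)) + p * q) + (y * q + p * x + 2 * (x * y)) ∎)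
    where open ≡-Reasoning

m[x+y]²≤[m+1]²xy : ∀ m x y → y ≤ m * x → x ≤ m * y → m * ((x + y) * (x + y)) ≤ (suc m * suc m) * (x * y)
m[x+y]²≤[m+1]²xy m x y y≤mx x≤my =
  subst (m * ((x + y) * (x + y)) ≤_) (sym ([m+1]²xy≡m[x+y]²+[mx∸y][my∸x] m x y y≤mx x≤my)) (ℕ.m≤m+n _ _)

m[x+y]²≡[m+1]²xy⇒ : ∀ m x y → y ≤ m * x → x ≤ m * y → m * ((x + y) * (x + y)) ≡ (suc m * suc m) * (x * y) →
  y ≡ m * x ⊎ x ≡ m * y
m[x+y]²≡[m+1]²xy⇒ m x y y≤mx x≤my eq = Sum.map
  (λ mx∸y≡0 → ℕ.≤-antisym y≤mx (ℕ.m∸n≡0⇒m≤n mx∸y≡0))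
  (λ my∸x≡0 → ℕ.≤-antisym x≤my (ℕ.m∸n≡0⇒m≤n my∸x≡0))
  (ℕ.m*n≡0⇒m≡0∨n≡0 (m * x ∸ y) (m+n≡m⇒n≡0 (m * ((x + y) * (x + y)))
    (trans (sym ([m+1]²xy≡m[x+y]²+[mx∸y][my∸x] m x y y≤mx x≤my)) (sym eq))))

private
  0<*0< : ∀ {x y} → 0 < x → 0 < y → 0 < x * y
  0<*0< {suc _} {suc _} _ _ = z<s

  0<+ : ∀ {x} y → 0 < x → 0 < x + y
  0<+ {suc _} _ _ = z<s

  module CrossMultiply (c d : ℕ) {x y : ℕ} (0<d : 0 < d) (0<x : 0 < x) (0<y : 0 < y) where
    s : ℕ
    s = x + y

    0<s : 0 < s
    0<s = 0<+ y 0<x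

    0<dxy : 0 < d * (x * y)
    0<dxy = 0<*0< 0<d (0<*0< 0<x 0<y)

    c/d[1/x+1/y]≡ : frac c d ℚ.* (frac 1 x ℚ.+ frac 1 y) ≡ frac (c * s) (d * (x * y))
    c/d[1/x+1/y]≡ = trans (cong (frac c d ℚ.*_) (1/x+1/y≡[x+y]/xy 0<x 0<y))
      (frac-* c d s (x * y) 0<d (0<*0< 0<x 0<y))

    c*s*s≡ : c * s * s ≡ c * (s * s)
    c*s*s≡ = ℕ.*-assoc c s s

    below : (d * (x * y) ≤ c * (s * s)) ⇔ (frac 1 s ≤ℚ frac c d ℚ.* (frac 1 x ℚ.+ frac 1 y))
    below = subst₂ (λ a b → (a ≤ b) ⇔ (frac 1 s ≤ℚ frac c d ℚ.* (frac 1 x ℚ.+ frac 1 y)))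
      (ℕ.*-identityˡ _) c*s*s≡
      (subst (λ q → (1 * (d * (x * y)) ≤ c * s * s) ⇔ (frac 1 s ≤ℚ q)) (sym c/d[1/x+1/y]≡)
        (frac-≤ 1 s (c * s) (d * (x * y)) 0<s 0<dxy))

    above : (c * (s * s) ≤ d * (x * y)) ⇔ (frac c d ℚ.* (frac 1 x ℚ.+ frac 1 y) ≤ℚ frac 1 s)
    above = subst₂ (λ a b → (a ≤ b) ⇔ (frac c d ℚ.* (frac 1 x ℚ.+ frac 1 y) ≤ℚ frac 1 s))
      c*s*s≡ (ℕ.*-identityˡ _)
      (subst (λ q → (c * s * s ≤ 1 * (d * (x * y))) ⇔ (q ≤ℚ frac 1 s)) (sym c/d[1/x+1/y]≡)
        (frac-≤ (c * s) (d * (x * y)) 1 s 0<dxy 0<s))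

    equal : (c * (s * s) ≡ d * (x * y)) ⇔ (frac c d ℚ.* (frac 1 x ℚ.+ frac 1 y) ≡ frac 1 s)
    equal = subst₂ (λ a b → (a ≡ b) ⇔ (frac c d ℚ.* (frac 1 x ℚ.+ frac 1 y) ≡ frac 1 s))
      c*s*s≡ (ℕ.*-identityˡ _)
      (subst (λ q → (c * s * s ≡ 1 * (d * (x * y))) ⇔ (q ≡ frac 1 s)) (sym c/d[1/x+1/y]≡)
        (frac-≡ (c * s) (d * (x * y)) 1 s 0<dxy 0<s))

1/[x+y]≤¼[1/x+1/y] : ∀ {x y} → 0 < x → 0 < y → frac 1 (x + y) ≤ℚ ¼ ℚ.* (frac 1 x ℚ.+ frac 1 y)
1/[x+y]≤¼[1/x+1/y] {x} {y} 0<x 0<y =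
  to (CrossMultiply.below 1 4 z<s 0<x 0<y) (subst (4 * (x * y) ≤_) (sym (ℕ.*-identityˡ _)) (4xy≤[x+y]² x y))

1/[x+y]≡¼[1/x+1/y]⇔x≡y : ∀ {x y} → 0 < x → 0 < y → (frac 1 (x + y) ≡ ¼ ℚ.* (frac 1 x ℚ.+ frac 1 y)) ⇔ (x ≡ y)
1/[x+y]≡¼[1/x+1/y]⇔x≡y {x} {y} 0<x 0<y = mk⇔
  (λ eq → 4xy≡[x+y]²⇒x≡y x y (sym (trans (sym (ℕ.*-identityˡ _)) (from equal (sym eq)))))
  (λ { refl → sym (to equal (trans (ℕ.*-identityˡ _) (sym (4xx≡[x+x]² x)))) })
  where
  open CrossMultiply 1 4 z<s 0<x 0<y using (equal)
  4xx≡[x+x]² : ∀ x → 4 * (x * x) ≡ (x + x) * (x + x)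
  4xx≡[x+x]² = solve-∀

m/[m+1]²[1/x+1/y]≤1/[x+y] : ∀ m {x y} → 0 < x → 0 < y → x ≤ m → y ≤ m →
  m/[m+1]² m ℚ.* (frac 1 x ℚ.+ frac 1 y) ≤ℚ frac 1 (x + y)
m/[m+1]²[1/x+1/y]≤1/[x+y] m {x} {y} 0<x 0<y x≤m y≤m = to (CrossMultiply.above m (suc m * suc m) z<s 0<x 0<y)
  (m[x+y]²≤[m+1]²xy m x y (y≤m⇒y≤m*x 0<x y≤m) (y≤m⇒y≤m*x 0<y x≤m))

m/[m+1]²[1/x+1/y]≡1/[x+y]⇒ : ∀ m {x y} → 0 < x → 0 < y → x ≤ m → y ≤ m →
  m/[m+1]² m ℚ.* (frac 1 x ℚ.+ frac 1 y) ≡ frac 1 (x + y) → x ≡ m ⊎ y ≡ m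
m/[m+1]²[1/x+1/y]≡1/[x+y]⇒ m {x} {y} 0<x 0<y x≤m y≤m eq = Sum.swap (Sum.map (≡m 0<x y≤m) (≡m 0<y x≤m)
  (m[x+y]²≡[m+1]²xy⇒ m x y (y≤m⇒y≤m*x 0<x y≤m) (y≤m⇒y≤m*x 0<y x≤m)
    (from (CrossMultiply.equal m (suc m * suc m) z<s 0<x 0<y) eq)))
  where
  ≡m : ∀ {x y} → 0 < x → y ≤ m → y ≡ m * x → y ≡ m
  ≡m 0<x y≤m refl = ℕ.≤-antisym y≤m (y≤m⇒y≤m*x 0<x ℕ.≤-refl)

Π-⇔ : ∀ {A : Set} {P Q : A → Set} → (∀ x → P x ⇔ Q x) → (∀ x → P x) ⇔ (∀ x → Q x)
Π-⇔ P⇔Q = mk⇔ (λ p x → to (P⇔Q x) (p x)) (λ q x → from (P⇔Q x) (q x))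

foldr-map-allFin : ∀ {A : Set} (_∙_ : Op₂ A) e {n} (f : Fin n → A) →
  List.foldr _∙_ e (List.map f (List.allFin n)) ≡ Vector.foldr _∙_ e f
foldr-map-allFin _∙_ e f = trans (cong (List.foldr _∙_ e) (List.map-tabulate id f)) (foldr-tabulate f)
  where
  foldr-tabulate : ∀ {n} (f : Fin n → _) → List.foldr _∙_ e (List.tabulate f) ≡ Vector.foldr _∙_ e f
  foldr-tabulate {zero}  f = refl
  foldr-tabulate {suc n} f = cong (f Fin.zero ∙_) (foldr-tabulate (f ∘ Fin.suc))

module MonotoneSum
  {A : Set} {_≤_ _<_ : Rel A 0ℓ} {_+_ : Op₂ A} {0# : A}
  (≤-refl : Reflexive _≤_) (≤-antisym : Antisymmetric _≡_ _≤_)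
  (≮⇒≥ : ∀ {a b} → ¬ a < b → b ≤ a) (<-irrefl : Irreflexive _≡_ _<_)
  (+-comm : Commutative _≡_ _+_)
  (+-mono-≤ : _+_ Preserves₂ _≤_ ⟶ _≤_ ⟶ _≤_) (+-mono-<-≤ : _+_ Preserves₂ _<_ ⟶ _≤_ ⟶ _<_)
  where

  sum : ∀ {n} → (Fin n → A) → A
  sum = Vector.foldr _+_ 0#

  +-≤-≡⇒≡ : ∀ {a b c d} → a ≤ b → c ≤ d → a + c ≡ b + d → a ≡ b
  +-≤-≡⇒≡ a≤b c≤d eq = ≤-antisym a≤b (≮⇒≥ (λ a<b → <-irrefl eq (+-mono-<-≤ a<b c≤d)))

  sum-mono-≤ : ∀ {n} {f g : Fin n → A} → (∀ i → f i ≤ g i) → sum f ≤ sum g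
  sum-mono-≤ {zero}  f≤g = ≤-refl
  sum-mono-≤ {suc n} f≤g = +-mono-≤ (f≤g Fin.zero) (sum-mono-≤ (f≤g ∘ Fin.suc))

  sum-≡⇒≗ : ∀ {n} {f g : Fin n → A} → (∀ i → f i ≤ g i) → sum f ≡ sum g → ∀ i → f i ≡ g i
  sum-≡⇒≗ f≤g eq Fin.zero    = +-≤-≡⇒≡ (f≤g Fin.zero) (sum-mono-≤ (f≤g ∘ Fin.suc)) eq
  sum-≡⇒≗ f≤g eq (Fin.suc i) = sum-≡⇒≗ (f≤g ∘ Fin.suc)
    (+-≤-≡⇒≡ (sum-mono-≤ (f≤g ∘ Fin.suc)) (f≤g Fin.zero) (trans (+-comm _ _) (trans eq (+-comm _ _)))) i

  sum-cong : ∀ {n} {f g : Fin n → A} → (∀ i → f i ≡ g i) → sum f ≡ sum g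
  sum-cong {zero}  _   = refl
  sum-cong {suc n} f≗g = cong₂ _+_ (f≗g Fin.zero) (sum-cong (f≗g ∘ Fin.suc))

  sum-≡⇔≗ : ∀ {n} {f g : Fin n → A} → (∀ i → f i ≤ g i) → (sum f ≡ sum g) ⇔ (∀ i → f i ≡ g i)
  sum-≡⇔≗ f≤g = mk⇔ (sum-≡⇒≗ f≤g) sum-cong

  sum²-mono-≤ : ∀ {m n} {f g : Fin m → Fin n → A} → (∀ i j → f i j ≤ g i j) →
    sum (λ i → sum (f i)) ≤ sum (λ i → sum (g i))
  sum²-mono-≤ f≤g = sum-mono-≤ (λ i → sum-mono-≤ (f≤g i))

  sum²-≡⇔≗ : ∀ {m n} {f g : Fin m → Fin n → A} → (∀ i j → f i j ≤ g i j) →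
    (sum (λ i → sum (f i)) ≡ sum (λ i → sum (g i))) ⇔ (∀ i j → f i j ≡ g i j)
  sum²-≡⇔≗ f≤g = ⇔-trans (sum-≡⇔≗ (λ i → sum-mono-≤ (f≤g i))) (Π-⇔ λ i → sum-≡⇔≗ (f≤g i))

-- MonotoneSum.sum is definitionally the library's sum, so its lemmas apply to ∑ below.
module ℕΣ where
  open import Algebra.Properties.Semiring.Sum ℕ.+-*-semiring public
  open MonotoneSum {0# = 0} ℕ.≤-refl ℕ.≤-antisym ℕ.≮⇒≥ ℕ.<-irrefl ℕ.+-comm ℕ.+-mono-≤ ℕ.+-mono-<-≤ public
    using (sum-mono-≤; sum-≡⇔≗)

module ℚΣ where
  open import Algebra.Properties.Semiring.Sum (Ring.semiring ℚ.+-*-ring) public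
  open MonotoneSum {0# = 0ℚ} ℚ.≤-refl ℚ.≤-antisym ℚ.≮⇒≥ ℚ.<-irrefl ℚ.+-comm ℚ.+-mono-≤ ℚ.+-mono-<-≤ public
    using (sum-mono-≤; sum-≡⇔≗; sum²-mono-≤; sum²-≡⇔≗)

open ℚΣ

Σℕ≡sum : ∀ {n} (f : Fin n → ℕ) → Σℕ f ≡ ℕΣ.sum f
Σℕ≡sum = foldr-map-allFin _+_ 0

Σℚ≡sum : ∀ {n} (f : Fin n → ℚ) → Σℚ f ≡ ∑[ i < n ] f i
Σℚ≡sum = foldr-map-allFin ℚ._+_ 0ℚ

indicator≤1 : ∀ b → indicator b ≤ 1
indicator≤1 true  = ℕ.≤-refl
indicator≤1 false = z≤n

indicator≡1⇒≡true : ∀ {b} → indicator b ≡ 1 → b ≡ true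
indicator≡1⇒≡true {true} _ = refl

0<indicator⇒≡true : ∀ {b} → 0 < indicator b → b ≡ true
0<indicator⇒≡true {true} _ = refl

indicator-∧ : ∀ a b → indicator (a ∧ b) ≡ indicator a * indicator b
indicator-∧ true  b = sym (ℕ.+-identityʳ (indicator b))
indicator-∧ false b = refl

sum-1 : ∀ n → ℕΣ.sum {n} (λ _ → 1) ≡ n
sum-1 zero    = refl
sum-1 (suc n) = cong suc (sum-1 n)

sum-indicator-≡ : ∀ {n} (c : Fin n) → ℕΣ.sum (λ i → indicator (does (i ≟ c))) ≡ 1
sum-indicator-≡ {suc n} Fin.zero    = cong suc (ℕΣ.sum-replicate-zero n)
sum-indicator-≡ {suc n} (Fin.suc c) = sum-indicator-≡ c

sum-indicator-≢ : ∀ {n} (c : Fin n) → ℕΣ.sum (λ i → indicator (not (does (i ≟ c)))) ≡ n ∸ 1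
sum-indicator-≢ {suc n}       Fin.zero    = sum-1 n
sum-indicator-≢ {suc (suc n)} (Fin.suc c) = cong suc (sum-indicator-≢ c)

≤-sum : ∀ {n} (f : Fin n → ℕ) i → f i ≤ ℕΣ.sum f
≤-sum {suc _} f i = ℕ.≤-trans (ℕ.m≤m+n (f i) _) (ℕ.≤-reflexive (sym (ℕΣ.sum-remove {i = i} f)))

sum-pos⇒∃ : ∀ {n} (f : Fin n → ℕ) → 0 < ℕΣ.sum f → ∃ λ i → 0 < f i
sum-pos⇒∃ {suc n} f 0<sum with f Fin.zero in eq
... | suc _ = Fin.zero , subst (0 <_) (sym eq) z<s
... | zero  = Product.map Fin.suc id (sum-pos⇒∃ (f ∘ Fin.suc) 0<sum)

sum-fromℕ : ∀ {n} (f : Fin n → ℕ) → ∑[ i < n ] fromℕ (f i) ≡ fromℕ (ℕΣ.sum f)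
sum-fromℕ {zero}  f = refl
sum-fromℕ {suc n} f = trans (cong (fromℕ (f Fin.zero) ℚ.+_) (sum-fromℕ (f ∘ Fin.suc)))
  (sym (fromℕ-+ (f Fin.zero) _))

sum-if : ∀ {n} (b : Fin n → Bool) x →
  ∑[ i < n ] (if b i then x else 0ℚ) ≡ fromℕ (ℕΣ.sum (indicator ∘ b)) ℚ.* x
sum-if {n} b x = begin
  ∑[ i < n ] (if b i then x else 0ℚ)         ≡⟨ sum-cong-≗ (λ i → if≡indicator* (b i)) ⟩
  ∑[ i < n ] (fromℕ (indicator (b i)) ℚ.* x) ≡⟨ *-distribʳ-sum x (fromℕ ∘ indicator ∘ b) ⟨
  ∑[ i < n ] fromℕ (indicator (b i)) ℚ.* x   ≡⟨ cong (ℚ._* x) (sum-fromℕ (indicator ∘ b)) ⟩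
  fromℕ (ℕΣ.sum (indicator ∘ b)) ℚ.* x       ∎
  where
  open ≡-Reasoning
  if≡indicator* : ∀ a → (if a then x else 0ℚ) ≡ fromℕ (indicator a) ℚ.* x
  if≡indicator* true  = sym (ℚ.*-identityˡ x)
  if≡indicator* false = sym (ℚ.*-zeroˡ x)

sum-const : ∀ n x → ∑[ i < n ] x ≡ fromℕ n ℚ.* x
sum-const n x = trans (sum-if {n} (λ _ → true) x) (cong (λ k → fromℕ k ℚ.* x) (sum-1 n))

transpose : ∀ {n} → Digraph n → Digraph n
transpose D = record { arc = λ u v → arc D v u ; noLoops = noLoops D }

outdeg≡sum : ∀ {n} (D : Digraph n) u → outdeg D u ≡ ℕΣ.sum (indicator ∘ arc D u)
outdeg≡sum D u = Σℕ≡sum (indicator ∘ arc D u)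

arc⇒0<outdeg : ∀ {n} (D : Digraph n) {u v} → arc D u v ≡ true → 0 < outdeg D u
arc⇒0<outdeg D {u} {v} uv = subst (0 <_) (sym (outdeg≡sum D u))
  (ℕ.≤-trans (ℕ.≤-reflexive (cong indicator (sym uv))) (≤-sum (indicator ∘ arc D u) v))

arc⇒0<indeg : ∀ {n} (D : Digraph n) {u v} → arc D u v ≡ true → 0 < indeg D v
arc⇒0<indeg D = arc⇒0<outdeg (transpose D)

0<outdeg⇒∃arc : ∀ {n} (D : Digraph n) {u} → 0 < outdeg D u → ∃ λ v → arc D u v ≡ true
0<outdeg⇒∃arc D {u} 0<out = Product.map₂ 0<indicator⇒≡true
  (sum-pos⇒∃ (indicator ∘ arc D u) (subst (0 <_) (outdeg≡sum D u) 0<out))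

¬Isolated⇒∃arc : ∀ {n} (D : Digraph n) {u} → ¬ Isolated D u → ∃ λ a → ∃ λ b → arc D a b ≡ true
¬Isolated⇒∃arc D {u} ¬isolated with outdeg D u in out | indeg D u in in′
... | suc _ | _     = u , 0<outdeg⇒∃arc D (subst (0 <_) (sym out) z<s)
... | zero  | suc _ = Product.map₂ (u ,_) (0<outdeg⇒∃arc (transpose D) (subst (0 <_) (sym in′) z<s))
... | zero  | zero  = ⊥-elim (¬isolated (refl , refl))

indicator-arc≤ : ∀ {n} (D : Digraph n) u v → indicator (arc D u v) ≤ indicator (not (does (v ≟ u)))
indicator-arc≤ D u v with v ≟ u
... | yes refl = ℕ.≤-reflexive (cong indicator (noLoops D u))
... | no _     = indicator≤1 (arc D u v)

outdeg≤n∸1 : ∀ {n} (D : Digraph n) u → outdeg D u ≤ n ∸ 1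
outdeg≤n∸1 D u = subst₂ _≤_ (sym (outdeg≡sum D u)) (sum-indicator-≢ u) (ℕΣ.sum-mono-≤ (indicator-arc≤ D u))

outdeg≡n∸1⇒arc : ∀ {n} (D : Digraph n) {u} → outdeg D u ≡ n ∸ 1 → ∀ v → v ≢ u → arc D u v ≡ true
outdeg≡n∸1⇒arc D {u} out≡ v v≢u = indicator≡1⇒≡true (trans
  (to (ℕΣ.sum-≡⇔≗ (indicator-arc≤ D u)) (trans (sym (outdeg≡sum D u)) (trans out≡ (sym (sum-indicator-≢ u)))) v)
  (cong (indicator ∘ not) (dec-false (v ≟ u) v≢u)))

arcTerm : ∀ {n} → Digraph n → Fin n → Fin n → ℚ
arcTerm D u v = if arc D u v then frac 1 (outdeg D u + indeg D v) else 0ℚ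

arcWeight : ∀ {n} → Digraph n → Fin n → Fin n → ℚ
arcWeight D u v = if arc D u v then frac 1 (outdeg D u) ℚ.+ frac 1 (indeg D v) else 0ℚ

vertexWeight : ∀ {n} → Digraph n → Fin n → ℚ
vertexWeight D u = sign (outdeg D u) ℚ.+ sign (indeg D u)

harmonic≡∑∑arcTerm : ∀ {n} (D : Digraph n) → harmonic D ≡ ∑[ u < n ] ∑[ v < n ] arcTerm D u v
harmonic≡∑∑arcTerm D = trans (Σℚ≡sum (λ u → Σℚ (arcTerm D u))) (sum-cong-≗ (λ u → Σℚ≡sum (arcTerm D u)))

harmonic-transpose : ∀ {n} (D : Digraph n) → harmonic (transpose D) ≡ harmonic D
harmonic-transpose {n} D = begin
  harmonic (transpose D)                           ≡⟨ harmonic≡∑∑arcTerm (transpose D) ⟩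
  ∑[ u < n ] ∑[ v < n ] arcTerm (transpose D) u v  ≡⟨ ∑-comm (arcTerm (transpose D)) ⟩
  ∑[ v < n ] ∑[ u < n ] arcTerm (transpose D) u v  ≡⟨ sum-cong-≗ (λ v → sum-cong-≗ (λ u →
                                                        cong (λ k → if arc D v u then frac 1 k else 0ℚ)
                                                          (ℕ.+-comm (indeg D u) (outdeg D v)))) ⟩
  ∑[ v < n ] ∑[ u < n ] arcTerm D v u              ≡⟨ harmonic≡∑∑arcTerm D ⟨
  harmonic D                                       ∎
  where open ≡-Reasoning

sum-if-arc : ∀ {n} (D : Digraph n) u x → ∑[ v < n ] (if arc D u v then x else 0ℚ) ≡ fromℕ (outdeg D u) ℚ.* x
sum-if-arc D u x = trans (sum-if (arc D u) x) (cong (λ k → fromℕ k ℚ.* x) (sym (outdeg≡sum D u)))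

-- The d⁺_u arcs leaving u carry 1/d⁺_u each at their tail, and dually at the heads.
∑∑arcWeight≡∑vertexWeight : ∀ {n} (D : Digraph n) →
  ∑[ u < n ] ∑[ v < n ] arcWeight D u v ≡ ∑[ u < n ] vertexWeight D u
∑∑arcWeight≡∑vertexWeight {n} D = begin
  ∑[ u < n ] ∑[ v < n ] arcWeight D u v
    ≡⟨ sum-cong-≗ (λ u → trans (sum-cong-≗ (λ v → if-+ (arc D u v))) (∑-distrib-+ (tail u) (λ v → head v u))) ⟩
  ∑[ u < n ] (∑[ v < n ] tail u v ℚ.+ ∑[ v < n ] head v u)
    ≡⟨ ∑-distrib-+ (λ u → ∑[ v < n ] tail u v) (λ u → ∑[ v < n ] head v u) ⟩
  ∑[ u < n ] ∑[ v < n ] tail u v ℚ.+ ∑[ u < n ] ∑[ v < n ] head v u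
    ≡⟨ cong (∑[ u < n ] ∑[ v < n ] tail u v ℚ.+_) (∑-comm (λ u v → head v u)) ⟩
  ∑[ u < n ] ∑[ v < n ] tail u v ℚ.+ ∑[ v < n ] ∑[ u < n ] head v u
    ≡⟨ cong₂ ℚ._+_ (sum-cong-≗ (λ u → trans (sum-if-arc D u _) (fromℕ*1/≡sign (outdeg D u))))
                   (sum-cong-≗ (λ v → trans (sum-if-arc (transpose D) v _) (fromℕ*1/≡sign (indeg D v)))) ⟩
  ∑[ u < n ] sign (outdeg D u) ℚ.+ ∑[ v < n ] sign (indeg D v)
    ≡⟨ ∑-distrib-+ (sign ∘ outdeg D) (sign ∘ indeg D) ⟨
  ∑[ u < n ] vertexWeight D u ∎
  where
  open ≡-Reasoning
  tail : Fin n → Fin n → ℚ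
  tail u v = if arc D u v then frac 1 (outdeg D u) else 0ℚ
  head : Fin n → Fin n → ℚ
  head v u = if arc D u v then frac 1 (indeg D v) else 0ℚ
  if-+ : ∀ {x y} b → (if b then x ℚ.+ y else 0ℚ) ≡ (if b then x else 0ℚ) ℚ.+ (if b then y else 0ℚ)
  if-+ true  = refl
  if-+ false = refl

∑∑c*arcWeight≡c*∑vertexWeight : ∀ {n} (D : Digraph n) c →
  ∑[ u < n ] ∑[ v < n ] (c ℚ.* arcWeight D u v) ≡ c ℚ.* ∑[ u < n ] vertexWeight D u
∑∑c*arcWeight≡c*∑vertexWeight {n} D c = begin
  ∑[ u < n ] ∑[ v < n ] (c ℚ.* arcWeight D u v) ≡⟨ sum-cong-≗ (λ u → *-distribˡ-sum c (arcWeight D u)) ⟨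
  ∑[ u < n ] (c ℚ.* ∑[ v < n ] arcWeight D u v) ≡⟨ *-distribˡ-sum c (λ u → ∑[ v < n ] arcWeight D u v) ⟨
  c ℚ.* ∑[ u < n ] ∑[ v < n ] arcWeight D u v   ≡⟨ cong (c ℚ.*_) (∑∑arcWeight≡∑vertexWeight D) ⟩
  c ℚ.* ∑[ u < n ] vertexWeight D u             ∎
  where open ≡-Reasoning

arcTerm≤¼arcWeight : ∀ {n} (D : Digraph n) u v → arcTerm D u v ≤ℚ ¼ ℚ.* arcWeight D u v
arcTerm≤¼arcWeight D u v with arc D u v in uv
... | true  = 1/[x+y]≤¼[1/x+1/y] (arc⇒0<outdeg D uv) (arc⇒0<indeg D uv)
... | false = ℚ.≤-reflexive (sym (ℚ.*-zeroʳ ¼))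

arcTerm≡¼arcWeight⇔ : ∀ {n} (D : Digraph n) u v →
  (arcTerm D u v ≡ ¼ ℚ.* arcWeight D u v) ⇔ (arc D u v ≡ true → outdeg D u ≡ indeg D v)
arcTerm≡¼arcWeight⇔ D u v with arc D u v in uv
... | true  = let balanced⇔ = 1/[x+y]≡¼[1/x+1/y]⇔x≡y (arc⇒0<outdeg D uv) (arc⇒0<indeg D uv) in
  mk⇔ (λ eq _ → to balanced⇔ eq) (λ balanced → from balanced⇔ (balanced refl))
... | false = mk⇔ (λ _ ()) (λ _ → sym (ℚ.*-zeroʳ ¼))

m/[m+1]²arcWeight≤arcTerm : ∀ {m} (D : Digraph (suc m)) u v → m/[m+1]² m ℚ.* arcWeight D u v ≤ℚ arcTerm D u v
m/[m+1]²arcWeight≤arcTerm {m} D u v with arc D u v in uv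
... | true  = m/[m+1]²[1/x+1/y]≤1/[x+y] m (arc⇒0<outdeg D uv) (arc⇒0<indeg D uv)
                (outdeg≤n∸1 D u) (outdeg≤n∸1 (transpose D) v)
... | false = ℚ.≤-reflexive (ℚ.*-zeroʳ (m/[m+1]² m))

m/[m+1]²arcWeight≡arcTerm⇒ : ∀ {m} (D : Digraph (suc m)) u v → m/[m+1]² m ℚ.* arcWeight D u v ≡ arcTerm D u v →
  arc D u v ≡ true → outdeg D u ≡ m ⊎ indeg D v ≡ m
m/[m+1]²arcWeight≡arcTerm⇒ {m} D u v with arc D u v in uv
... | true  = λ eq _ → m/[m+1]²[1/x+1/y]≡1/[x+y]⇒ m (arc⇒0<outdeg D uv) (arc⇒0<indeg D uv)
                         (outdeg≤n∸1 D u) (outdeg≤n∸1 (transpose D) v) eq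
... | false = λ _ ()

sign+sign≤2 : ∀ x y → sign x ℚ.+ sign y ≤ℚ fromℕ 2
sign+sign≤2 zero    zero    = to (frac-≤ 0 1 2 1 z<s z<s) z≤n
sign+sign≤2 zero    (suc _) = to (frac-≤ 1 1 2 1 z<s z<s) (s≤s z≤n)
sign+sign≤2 (suc _) zero    = to (frac-≤ 1 1 2 1 z<s z<s) (s≤s z≤n)
sign+sign≤2 (suc _) (suc _) = ℚ.≤-refl

sign+sign≡2⇔ : ∀ x y → (sign x ℚ.+ sign y ≡ fromℕ 2) ⇔ (0 < x × 0 < y)
sign+sign≡2⇔ zero    zero    = mk⇔ (λ ()) (λ ())
sign+sign≡2⇔ zero    (suc _) = mk⇔ (λ ()) (λ ())
sign+sign≡2⇔ (suc _) zero    = mk⇔ (λ ()) (λ ())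
sign+sign≡2⇔ (suc _) (suc _) = mk⇔ (λ _ → z<s , z<s) (λ _ → refl)

1≤sign+sign : ∀ x y → ¬ (x ≡ 0 × y ≡ 0) → 1ℚ ≤ℚ sign x ℚ.+ sign y
1≤sign+sign zero    zero    ¬both0 = ⊥-elim (¬both0 (refl , refl))
1≤sign+sign zero    (suc _) _      = ℚ.≤-refl
1≤sign+sign (suc _) zero    _      = ℚ.≤-refl
1≤sign+sign (suc _) (suc _) _      = to (frac-≤ 1 1 2 1 z<s z<s) (s≤s z≤n)

sign+sign≡1⇒ : ∀ x y → sign x ℚ.+ sign y ≡ 1ℚ → (0 < x → y ≡ 0) × (0 < y → x ≡ 0)
sign+sign≡1⇒ zero    zero    ()
sign+sign≡1⇒ zero    (suc _) _  = (λ ()) , (λ _ → refl)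
sign+sign≡1⇒ (suc _) zero    _  = (λ _ → refl) , (λ ())
sign+sign≡1⇒ (suc _) (suc _) ()

-- Stars

maximal-outdeg⇒IsOutStar : ∀ {n} (D : Digraph n) {c} → (∀ w → 0 < indeg D w → outdeg D w ≡ 0) →
  outdeg D c ≡ n ∸ 1 → IsOutStar D
maximal-outdeg⇒IsOutStar D {c} sinks out≡ = c , λ u v → mk⇔ (centred u v) λ { (refl , v≢c) → full v v≢c }
  where
  full : ∀ v → v ≢ c → arc D c v ≡ true
  full = outdeg≡n∸1⇒arc D out≡
  centred : ∀ u v → arc D u v ≡ true → u ≡ c × v ≢ c
  centred u v uv with u ≟ c
  ... | yes refl = refl , λ { refl → case trans (sym uv) (noLoops D c) of λ () }
  ... | no u≢c   = ⊥-elim (ℕ.<-irrefl (sym (sinks u (arc⇒0<indeg D (full u u≢c)))) (arc⇒0<outdeg D uv))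

IsInStar⇔IsOutStar-transpose : ∀ {n} (D : Digraph n) → IsInStar D ⇔ IsOutStar (transpose D)
IsInStar⇔IsOutStar-transpose D = mk⇔
  (Product.map₂ λ star u v → mk⇔ (Product.swap ∘ to (star v u)) (from (star v u) ∘ Product.swap))
  (Product.map₂ λ star u v → mk⇔ (Product.swap ∘ to (star v u)) (from (star v u) ∘ Product.swap))

IsOutStar⇒arc≡ : ∀ {n} (D : Digraph n) {c} → (∀ u v → (arc D u v ≡ true) ⇔ (u ≡ c × v ≢ c)) →
  ∀ u v → arc D u v ≡ does (u ≟ c) ∧ not (does (v ≟ c))
IsOutStar⇒arc≡ D {c} star u v with arc D u v in uv
... | true  = let u≡c , v≢c = to (star u v) uv in
  sym (cong₂ (λ a b → a ∧ not b) (dec-true (u ≟ c) u≡c) (dec-false (v ≟ c) v≢c))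
... | false with u ≟ c | v ≟ c
...   | yes u≡c | no v≢c = case trans (sym (from (star u v) (u≡c , v≢c))) uv of λ ()
...   | yes _   | yes _  = refl
...   | no _    | _      = refl

module _ {n} (D : Digraph n) {c} (star : ∀ u v → (arc D u v ≡ true) ⇔ (u ≡ c × v ≢ c)) where

  private
    [u≡c] : Fin n → ℕ
    [u≡c] u = indicator (does (u ≟ c))

    [v≢c] : Fin n → ℕ
    [v≢c] v = indicator (not (does (v ≟ c)))

    indicator-arc : ∀ u v → indicator (arc D u v) ≡ [u≡c] u * [v≢c] v
    indicator-arc u v = trans (cong indicator (IsOutStar⇒arc≡ D star u v)) (indicator-∧ (does (u ≟ c)) (not (does (v ≟ c))))

  outdeg-IsOutStar : ∀ u → outdeg D u ≡ [u≡c] u * (n ∸ 1)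
  outdeg-IsOutStar u = begin
    outdeg D u                          ≡⟨ outdeg≡sum D u ⟩
    ℕΣ.sum (indicator ∘ arc D u)        ≡⟨ ℕΣ.sum-cong-≗ (indicator-arc u) ⟩
    ℕΣ.sum (λ v → [u≡c] u * [v≢c] v)    ≡⟨ ℕΣ.*-distribˡ-sum ([u≡c] u) [v≢c] ⟨
    [u≡c] u * ℕΣ.sum [v≢c]              ≡⟨ cong ([u≡c] u *_) (sum-indicator-≢ c) ⟩
    [u≡c] u * (n ∸ 1)                   ∎
    where open ≡-Reasoning

  indeg-IsOutStar : ∀ v → indeg D v ≡ [v≢c] v
  indeg-IsOutStar v = begin
    indeg D v                            ≡⟨ outdeg≡sum (transpose D) v ⟩
    ℕΣ.sum (λ u → indicator (arc D u v)) ≡⟨ ℕΣ.sum-cong-≗ (λ u → indicator-arc u v) ⟩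
    ℕΣ.sum (λ u → [u≡c] u * [v≢c] v)     ≡⟨ ℕΣ.*-distribʳ-sum ([v≢c] v) [u≡c] ⟨
    ℕΣ.sum [u≡c] * [v≢c] v               ≡⟨ cong (_* [v≢c] v) (sum-indicator-≡ c) ⟩
    1 * [v≢c] v                          ≡⟨ ℕ.*-identityˡ _ ⟩
    [v≢c] v                              ∎
    where open ≡-Reasoning

  arc⇒outdeg+indeg≡ : ∀ {u v} → arc D u v ≡ true → outdeg D u + indeg D v ≡ n ∸ 1 + 1
  arc⇒outdeg+indeg≡ {u} {v} uv = let u≡c , v≢c = to (star u v) uv in cong₂ _+_
    (trans (outdeg-IsOutStar u) (trans (cong (λ b → indicator b * (n ∸ 1)) (dec-true (u ≟ c) u≡c)) (ℕ.*-identityˡ _)))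
    (trans (indeg-IsOutStar v) (cong (indicator ∘ not) (dec-false (v ≟ c) v≢c)))

  sum-outdeg-IsOutStar : ℕΣ.sum (outdeg D) ≡ n ∸ 1
  sum-outdeg-IsOutStar = begin
    ℕΣ.sum (outdeg D)                 ≡⟨ ℕΣ.sum-cong-≗ outdeg-IsOutStar ⟩
    ℕΣ.sum (λ u → [u≡c] u * (n ∸ 1))  ≡⟨ ℕΣ.*-distribʳ-sum (n ∸ 1) [u≡c] ⟨
    ℕΣ.sum [u≡c] * (n ∸ 1)            ≡⟨ cong (_* (n ∸ 1)) (sum-indicator-≡ c) ⟩
    1 * (n ∸ 1)                       ≡⟨ ℕ.*-identityˡ _ ⟩
    n ∸ 1                             ∎
    where open ≡-Reasoning

IsOutStar⇒harmonic≡ : ∀ {m} (D : Digraph (suc m)) → IsOutStar D → harmonic D ≡ frac m (suc m)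
IsOutStar⇒harmonic≡ {m} D (c , star) = begin
  harmonic D                                                    ≡⟨ harmonic≡∑∑arcTerm D ⟩
  ∑[ u < suc m ] ∑[ v < suc m ] arcTerm D u v                   ≡⟨ sum-cong-≗ (λ u → sum-cong-≗ (arcTerm≡ u)) ⟩
  ∑[ u < suc m ] ∑[ v < suc m ] (if arc D u v then 1/n else 0ℚ) ≡⟨ sum-cong-≗ (λ u → sum-if-arc D u 1/n) ⟩
  ∑[ u < suc m ] (fromℕ (outdeg D u) ℚ.* 1/n)                   ≡⟨ *-distribʳ-sum 1/n (fromℕ ∘ outdeg D) ⟨
  ∑[ u < suc m ] fromℕ (outdeg D u) ℚ.* 1/n                     ≡⟨ cong (ℚ._* 1/n) (sum-fromℕ (outdeg D)) ⟩
  fromℕ (ℕΣ.sum (outdeg D)) ℚ.* 1/n                             ≡⟨ cong (λ k → fromℕ k ℚ.* 1/n) (sum-outdeg-IsOutStar D star) ⟩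
  fromℕ m ℚ.* 1/n                                               ≡⟨ frac-* m 1 1 (suc m) z<s z<s ⟩
  frac (m * 1) (1 * suc m)                                      ≡⟨ cong₂ frac (ℕ.*-identityʳ m) (ℕ.*-identityˡ (suc m)) ⟩
  frac m (suc m)                                                ∎
  where
  open ≡-Reasoning
  1/n : ℚ
  1/n = frac 1 (suc m)
  arcTerm≡ : ∀ u v → arcTerm D u v ≡ (if arc D u v then 1/n else 0ℚ)
  arcTerm≡ u v with arc D u v in uv
  ... | true  = cong (frac 1) (trans (arc⇒outdeg+indeg≡ D star uv) (ℕ.+-comm m 1))
  ... | false = refl

-- The two bounds

module _ {n} (D : Digraph n) where

  vertexWeight≤2 : ∀ u → vertexWeight D u ≤ℚ fromℕ 2
  vertexWeight≤2 u = sign+sign≤2 (outdeg D u) (indeg D u)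

  harmonic≤¼∑vertexWeight : harmonic D ≤ℚ ¼ ℚ.* ∑[ u < n ] vertexWeight D u
  harmonic≤¼∑vertexWeight = begin
    harmonic D                                    ≡⟨ harmonic≡∑∑arcTerm D ⟩
    ∑[ u < n ] ∑[ v < n ] arcTerm D u v           ≤⟨ sum²-mono-≤ (arcTerm≤¼arcWeight D) ⟩
    ∑[ u < n ] ∑[ v < n ] (¼ ℚ.* arcWeight D u v) ≡⟨ ∑∑c*arcWeight≡c*∑vertexWeight D ¼ ⟩
    ¼ ℚ.* ∑[ u < n ] vertexWeight D u             ∎
    where open ℚ.≤-Reasoning

  harmonic≡¼∑vertexWeight⇔ :
    (harmonic D ≡ ¼ ℚ.* ∑[ u < n ] vertexWeight D u) ⇔ (∀ u v → arc D u v ≡ true → outdeg D u ≡ indeg D v)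
  harmonic≡¼∑vertexWeight⇔ = subst₂ (λ a b → (a ≡ b) ⇔ (∀ u v → arc D u v ≡ true → outdeg D u ≡ indeg D v))
    (sym (harmonic≡∑∑arcTerm D)) (∑∑c*arcWeight≡c*∑vertexWeight D ¼)
    (⇔-trans (sum²-≡⇔≗ (arcTerm≤¼arcWeight D)) (Π-⇔ λ u → Π-⇔ (arcTerm≡¼arcWeight⇔ D u)))

  ¼∑2≡n/2 : ¼ ℚ.* ∑[ u < n ] fromℕ 2 ≡ frac n 2
  ¼∑2≡n/2 = begin
    ¼ ℚ.* ∑[ u < n ] fromℕ 2    ≡⟨ cong (¼ ℚ.*_) (trans (sum-const n (fromℕ 2)) (frac-* n 1 2 1 z<s z<s)) ⟩
    ¼ ℚ.* frac (n * 2) (1 * 1)  ≡⟨ frac-* 1 4 (n * 2) 1 z<s z<s ⟩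
    frac (1 * (n * 2)) (4 * 1)  ≡⟨ to (frac-≡ (1 * (n * 2)) (4 * 1) n 2 z<s z<s) (cross n) ⟩
    frac n 2                    ∎
    where
    open ≡-Reasoning
    cross : ∀ n → 1 * (n * 2) * 2 ≡ n * (4 * 1)
    cross = solve-∀

  ¼∑vertexWeight≤n/2 : ¼ ℚ.* ∑[ u < n ] vertexWeight D u ≤ℚ frac n 2
  ¼∑vertexWeight≤n/2 = begin
    ¼ ℚ.* ∑[ u < n ] vertexWeight D u ≤⟨ ℚ.*-monoˡ-≤-nonNeg ¼ (sum-mono-≤ vertexWeight≤2) ⟩
    ¼ ℚ.* ∑[ u < n ] fromℕ 2          ≡⟨ ¼∑2≡n/2 ⟩
    frac n 2                          ∎
    where open ℚ.≤-Reasoning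

  ¼∑vertexWeight≡n/2⇔ :
    (¼ ℚ.* ∑[ u < n ] vertexWeight D u ≡ frac n 2) ⇔ (∀ u → 0 < outdeg D u × 0 < indeg D u)
  ¼∑vertexWeight≡n/2⇔ = ⇔-trans
    (mk⇔ (λ eq → *-cancelˡ-≡-pos ¼ (trans eq (sym ¼∑2≡n/2))) (λ eq → trans (cong (¼ ℚ.*_) eq) ¼∑2≡n/2))
    (⇔-trans (sum-≡⇔≗ vertexWeight≤2) (Π-⇔ λ u → sign+sign≡2⇔ (outdeg D u) (indeg D u)))

m/[m+1]²∑1≡m/[m+1] : ∀ m → m/[m+1]² m ℚ.* ∑[ u < suc m ] 1ℚ ≡ frac m (suc m)
m/[m+1]²∑1≡m/[m+1] m = begin
  m/[m+1]² m ℚ.* ∑[ u < suc m ] 1ℚ      ≡⟨ cong (m/[m+1]² m ℚ.*_) (trans (sum-const (suc m) 1ℚ) (ℚ.*-identityʳ _)) ⟩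
  m/[m+1]² m ℚ.* fromℕ (suc m)          ≡⟨ frac-* m (suc m * suc m) (suc m) 1 z<s z<s ⟩
  frac (m * suc m) (suc m * suc m * 1)  ≡⟨ to (frac-≡ (m * suc m) (suc m * suc m * 1) m (suc m) z<s z<s) (cross m) ⟩
  frac m (suc m)                        ∎
  where
  open ≡-Reasoning
  cross : ∀ m → m * suc m * suc m ≡ m * (suc m * suc m * 1)
  cross = solve-∀

module _ {m} (D : Digraph (suc m)) where

  private instance
    m/[m+1]²-nonNeg : ℚ.NonNegative (m/[m+1]² m)
    m/[m+1]²-nonNeg = ℚ.normalize-nonNeg m (suc m * suc m)

  ¬Isolated⇒1≤vertexWeight : (∀ u → ¬ Isolated D u) → ∀ u → 1ℚ ≤ℚ vertexWeight D u
  ¬Isolated⇒1≤vertexWeight ¬isolated u = 1≤sign+sign (outdeg D u) (indeg D u) (¬isolated u)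

  m/[m+1]≤m/[m+1]²∑vertexWeight : (∀ u → ¬ Isolated D u) →
    frac m (suc m) ≤ℚ m/[m+1]² m ℚ.* ∑[ u < suc m ] vertexWeight D u
  m/[m+1]≤m/[m+1]²∑vertexWeight ¬isolated = begin
    frac m (suc m)                                 ≡⟨ m/[m+1]²∑1≡m/[m+1] m ⟨
    m/[m+1]² m ℚ.* ∑[ u < suc m ] 1ℚ               ≤⟨ ℚ.*-monoˡ-≤-nonNeg (m/[m+1]² m)
                                                        (sum-mono-≤ (¬Isolated⇒1≤vertexWeight ¬isolated)) ⟩
    m/[m+1]² m ℚ.* ∑[ u < suc m ] vertexWeight D u ∎
    where open ℚ.≤-Reasoning

  m/[m+1]≡m/[m+1]²∑vertexWeight⇒ : .{{_ : ℕ.NonZero m}} → (∀ u → ¬ Isolated D u) →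
    frac m (suc m) ≡ m/[m+1]² m ℚ.* ∑[ u < suc m ] vertexWeight D u → ∀ u → vertexWeight D u ≡ 1ℚ
  m/[m+1]≡m/[m+1]²∑vertexWeight⇒ ¬isolated eq u = sym (to (sum-≡⇔≗ (¬Isolated⇒1≤vertexWeight ¬isolated))
    (*-cancelˡ-≡-pos (m/[m+1]² m) {{ℚ.normalize-pos m (suc m * suc m)}} (trans (m/[m+1]²∑1≡m/[m+1] m) eq)) u)

  m/[m+1]²∑vertexWeight≤harmonic : m/[m+1]² m ℚ.* ∑[ u < suc m ] vertexWeight D u ≤ℚ harmonic D
  m/[m+1]²∑vertexWeight≤harmonic = begin
    m/[m+1]² m ℚ.* ∑[ u < suc m ] vertexWeight D u                 ≡⟨ ∑∑c*arcWeight≡c*∑vertexWeight D (m/[m+1]² m) ⟨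
    ∑[ u < suc m ] ∑[ v < suc m ] (m/[m+1]² m ℚ.* arcWeight D u v) ≤⟨ sum²-mono-≤ (m/[m+1]²arcWeight≤arcTerm D) ⟩
    ∑[ u < suc m ] ∑[ v < suc m ] arcTerm D u v                    ≡⟨ harmonic≡∑∑arcTerm D ⟨
    harmonic D                                                     ∎
    where open ℚ.≤-Reasoning

  m/[m+1]²∑vertexWeight≡harmonic⇒ : m/[m+1]² m ℚ.* ∑[ u < suc m ] vertexWeight D u ≡ harmonic D →
    ∀ u v → arc D u v ≡ true → outdeg D u ≡ m ⊎ indeg D v ≡ m
  m/[m+1]²∑vertexWeight≡harmonic⇒ eq u v = m/[m+1]²arcWeight≡arcTerm⇒ D u v
    (to (sum²-≡⇔≗ (m/[m+1]²arcWeight≤arcTerm D))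
      (trans (∑∑c*arcWeight≡c*∑vertexWeight D (m/[m+1]² m)) (trans eq (harmonic≡∑∑arcTerm D))) u v)

  extremal⇒star : (∀ u → ¬ Isolated D u) → (∀ u → vertexWeight D u ≡ 1ℚ) →
    (∀ u v → arc D u v ≡ true → outdeg D u ≡ m ⊎ indeg D v ≡ m) → IsOutStar D ⊎ IsInStar D
  extremal⇒star ¬isolated weight≡1 extremal with ¬Isolated⇒∃arc D (¬isolated Fin.zero)
  ... | a , b , ab = Sum.map
    (maximal-outdeg⇒IsOutStar D λ w → proj₂ (pure w))
    (from (IsInStar⇔IsOutStar-transpose D) ∘ maximal-outdeg⇒IsOutStar (transpose D) λ w → proj₁ (pure w))
    (extremal a b ab)
    where
    pure : ∀ w → (0 < outdeg D w → indeg D w ≡ 0) × (0 < indeg D w → outdeg D w ≡ 0)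
    pure w = sign+sign≡1⇒ (outdeg D w) (indeg D w) (weight≡1 w)

  star⇒harmonic≡ : IsOutStar D ⊎ IsInStar D → harmonic D ≡ frac m (suc m)
  star⇒harmonic≡ (inj₁ outStar) = IsOutStar⇒harmonic≡ D outStar
  star⇒harmonic≡ (inj₂ inStar)  = trans (sym (harmonic-transpose D))
    (IsOutStar⇒harmonic≡ (transpose D) (to (IsInStar⇔IsOutStar-transpose D) inStar))

corollary11 : (n : ℕ) → 2 ≤ n → (D : Digraph n) → (∀ u → ¬ Isolated D u) →
  (harmonic D ≤ℚ frac n 2)
  × ((harmonic D ≡ frac n 2) ⇔
      ((∀ u v → arc D u v ≡ true → outdeg D u ≡ indeg D v)
        × (∀ u → (0 < outdeg D u) × (0 < indeg D u))))
  × (frac (n ∸ 1) n ≤ℚ harmonic D)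
  × ((harmonic D ≡ frac (n ∸ 1) n) ⇔ (IsOutStar D ⊎ IsInStar D))
corollary11 (suc zero)        (s≤s ()) _ _
corollary11 n@(suc m@(suc _)) _        D ¬isolated =
  ℚ.≤-trans upper₁ upper₂ ,
  ⇔-trans (≤-≤-squeeze upper₁ upper₂) (harmonic≡¼∑vertexWeight⇔ D ×-⇔ ¼∑vertexWeight≡n/2⇔ D) ,
  ℚ.≤-trans lower₁ lower₂ ,
  mk⇔ (λ eq → let weights , arcs = to (≤-≤-squeeze lower₁ lower₂) (sym eq) in
         extremal⇒star D ¬isolated (m/[m+1]≡m/[m+1]²∑vertexWeight⇒ D ¬isolated weights)
                                   (m/[m+1]²∑vertexWeight≡harmonic⇒ D arcs))
      (star⇒harmonic≡ D)
  where
  upper₁ : harmonic D ≤ℚ ¼ ℚ.* ∑[ u < n ] vertexWeight D u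
  upper₁ = harmonic≤¼∑vertexWeight D
  upper₂ : ¼ ℚ.* ∑[ u < n ] vertexWeight D u ≤ℚ frac n 2
  upper₂ = ¼∑vertexWeight≤n/2 D
  lower₁ : frac m n ≤ℚ m/[m+1]² m ℚ.* ∑[ u < n ] vertexWeight D u
  lower₁ = m/[m+1]≤m/[m+1]²∑vertexWeight D ¬isolated
  lower₂ : m/[m+1]² m ℚ.* ∑[ u < n ] vertexWeight D u ≤ℚ harmonic D
  lower₂ = m/[m+1]²∑vertexWeight≤harmonic D
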